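{- For every integer $n\geq 2$, $$D_n=\lfloor (e+e^{ -1})\,n!\rfloor-\lfloor e\, n!\rfloor .$$
   Context: $D_n$ denotes the number of derangements of $n$ distinct objects (permutations of an $n$-element set with no fixed point). $\lfloor x\rfloor$ denotes the floor of $x$. -}

module Defs where

open import Data.Nat using (ℕ; zero; suc; _!)
import Data.Nat
open import Data.Nat.Properties using (_!≢0)
open import Data.Integer using (ℤ; +_; -[1+_])
open import Data.Rational using (ℚ; _/_; _+_; _*_; _-_; _≤_; _<_; 0ℚ)
open import Data.Fin using (Fin)
open import Data.Fin.Properties using (all?) renaming (_≟_ to _≟ᶠ_)
open import Data.Vec using (Vec; []; _∷_; lookup)
open import Data.List using (List; []; _∷_; map; concatMap; length; filter; allFin)
open import Data.Product using (_×_; Σ; ∃)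
open import Relation.Binary.PropositionalEquality using (_≡_; _≢_)
open import Relation.Nullary using (Dec; ¬?)
open import Relation.Nullary.Decidable using (_×-dec_; _→-dec_)

vecs : (k m : ℕ) → List (Vec (Fin m) k)
vecs zero    m = [] ∷ []
vecs (suc k) m = concatMap (λ i → map (i ∷_) (vecs k m)) (allFin m)

-- A self-map σ of Fin n (given as its table of values) is a derangement iff
-- it is a permutation (injective self-map of a finite set) with no fixed point.
IsDerangement : (n : ℕ) → Vec (Fin n) n → Set
IsDerangement n σ =
  (∀ i j → lookup σ i ≡ lookup σ j → i ≡ j) × (∀ i → lookup σ i ≢ i)

isDerangement? : (n : ℕ) (σ : Vec (Fin n) n) → Dec (IsDerangement n σ)
isDerangement? n σ =
  all? (λ i → all? (λ j → (lookup σ i ≟ᶠ lookup σ j) →-dec (i ≟ᶠ j)))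
  ×-dec all? (λ i → ¬? (lookup σ i ≟ᶠ i))

D : ℕ → ℕ
D n = length (filter (isDerangement? n) (vecs n n))

-- e and e⁻¹ as limits of their (rational) partial sums

inv! : ℕ → ℚ
inv! k = (+ 1 / (k !)) {{k !≢0}}

sign : ℕ → ℚ
sign zero    = + 1 / 1
sign (suc k) = 0ℚ - sign k

eₚ : ℕ → ℚ
eₚ zero    = inv! zero
eₚ (suc N) = eₚ N + inv! (suc N)

e⁻¹ₚ : ℕ → ℚ
e⁻¹ₚ zero    = inv! zero
e⁻¹ₚ (suc N) = e⁻¹ₚ N + sign (suc N) * inv! (suc N)

ℕ→ℚ : ℕ → ℚ
ℕ→ℚ k = + k / 1

ℤ→ℚ : ℤ → ℚ
ℤ→ℚ m = m / 1

-- FloorLim s m  means  m ≤ lim s < m + 1, expressed via the sequence: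
--   m ≤ lim s      iff  ∀ ε > 0, eventually  m - ε ≤ s M
--   lim s < m + 1  iff  ∃ ε > 0, eventually  s M ≤ (m + 1) - ε

Eventually : (ℕ → Set) → Set
Eventually P = ∃ λ N → ∀ M → N Data.Nat.≤ M → P M

FloorLim : (ℕ → ℚ) → ℤ → Set
FloorLim s m =
  (∀ (ε : ℚ) → 0ℚ < ε → Eventually (λ M → ℤ→ℚ m - ε ≤ s M))
  × (Σ ℚ λ ε → 0ℚ < ε × Eventually (λ M → s M ≤ (ℤ→ℚ m + ℚ1) - ε))
  where ℚ1 = + 1 / 1

e·n! : ℕ → ℕ → ℚ
e·n! n M = eₚ M * ℕ→ℚ (n !)

[e+e⁻¹]·n! : ℕ → ℕ → ℚ
[e+e⁻¹]·n! n M = (eₚ M + e⁻¹ₚ M) * ℕ→ℚ (n !)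

{-# OPTIONS --safe #-}
-- With E M = Σ_{k ≤ M} M!/k! (arrangements) and d M the subfactorial, clearing denominators
-- gives eₚ M · M! = E M and e⁻¹ₚ M · M! = d M. Both E and E + d satisfy a recurrence
-- F (M + 1) = (M + 1) F M + c M, with c M = 1 and c M = 2 [M odd] respectively. Unrolling it
-- from n to M = n + j gives (F M / M!) · n! = F n + tail / rising, and the fraction stays in
-- [0, 2/3] as long as 3 c M ≤ 2 M for M ≥ n, which holds for n ≥ 2. Hence the two floors are
-- E n + d n and E n. That d n counts derangements is shown by filling the permutation one
-- position at a time: the number of completions depends only on how many of the remaining
-- constraints t i ≠ f i still exclude an unused value.
module Submission where

module Derangements where

  open import Data.Bool.Base using (Bool; true; false; not; _∧_; _∨_)
  open import Data.Bool.Properties using (∧-zeroʳ)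
  open import Data.Fin.Base using (Fin; zero; suc)
  open import Data.Fin.Properties using (_≟_; 0≢1+n) renaming (suc-injective to Fin-suc-injective)
  open import Data.List.Base using (List; []; _∷_; length; filter; map; concatMap; tabulate; _++_)
  open import Data.List.Properties using (length-++; filter-++; filter-≐; filter-none)
  import Data.List.Relation.Unary.All as ListAll
  open import Data.Nat.Base using (ℕ; zero; suc; pred; _+_; _*_)
  open import Data.Nat.Properties
    using (suc-injective; +-suc; +-identityʳ; +-cancelˡ-≡; +-commutativeSemigroup; +-*-semiring)
  open import Algebra.Properties.CommutativeSemigroup +-commutativeSemigroup
    using (x∙yz≈y∙xz; xy∙z≈y∙xz)
  open import Algebra.Properties.Semiring.Sum +-*-semiring
    using (sum; ∑-distrib-+; sum-cong-≗; sum-replicate-zero; *-distribʳ-sum)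
  open import Data.Nat.Tactic.RingSolver using (solve-∀)
  open import Data.Product.Base using (_×_; _,_; proj₁; proj₂)
  open import Data.Unit.Base using (⊤; tt)
  open import Data.Vec.Base as Vec using (Vec; []; _∷_; lookup)
  open import Data.Vec.Properties using (lookup-allFin)
  open import Data.Vec.Relation.Unary.All using (All; _∷_)
  open import Data.Vec.Relation.Unary.AllPairs using ([]; _∷_)
  open import Data.Vec.Relation.Unary.Any using (here; there)
  open import Data.Vec.Relation.Unary.Unique.Propositional using (Unique)
  open import Data.Vec.Relation.Unary.Unique.Propositional.Properties using (tabulate⁺)
  open import Function.Base using (id; _∘_)
  open import Relation.Binary.PropositionalEquality
    using (_≡_; _≢_; refl; sym; trans; cong; cong₂; module ≡-Reasoning)
  open import Relation.Nullary.Decidable using (Dec; yes; no; does; ¬?; _×-dec_; dec-false)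
  open import Relation.Nullary.Negation using (contradiction)
  open import Relation.Unary using (Pred; Decidable)
  open import Defs using (vecs; D; IsDerangement; isDerangement?)

  𝟙 : Bool → ℕ
  𝟙 true  = 1
  𝟙 false = 0

  𝟙-∧-split : ∀ a b → 𝟙 a ≡ 𝟙 (a ∧ b) + 𝟙 (a ∧ not b)
  𝟙-∧-split true  true  = refl
  𝟙-∧-split true  false = refl
  𝟙-∧-split false b     = refl

  length-filter-×-dec : ∀ {a b p} {A : Set a} {B : Set b} {Q : Pred B p}
    (a? : Dec A) (Q? : Decidable Q) (xs : List B) →
    length (filter (λ x → a? ×-dec Q? x) xs) ≡ 𝟙 (does a?) * length (filter Q? xs)
  length-filter-×-dec (yes a) Q? xs =
    trans (cong length (filter-≐ (λ x → yes a ×-dec Q? x) Q? (proj₂ , (a ,_)) xs)) (sym (+-identityʳ _))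
  length-filter-×-dec (no ¬a) Q? xs =
    cong length (filter-none (λ x → no ¬a ×-dec Q? x) (ListAll.universal (λ _ → ¬a ∘ proj₁) xs))

  module _ {b p} {B : Set b} {P : Pred B p} (P? : Decidable P) where

    length-filter-map : ∀ {a} {A : Set a} (f : A → B) (xs : List A) →
      length (filter P? (map f xs)) ≡ length (filter (P? ∘ f) xs)
    length-filter-map f []       = refl
    length-filter-map f (x ∷ xs) with does (P? (f x))
    ... | true  = cong suc (length-filter-map f xs)
    ... | false = length-filter-map f xs

    length-filter-++ : (xs ys : List B) →
      length (filter P? (xs ++ ys)) ≡ length (filter P? xs) + length (filter P? ys)
    length-filter-++ xs ys = trans (cong length (filter-++ P? xs ys)) (length-++ (filter P? xs))

  length-filter-vecs-suc : ∀ {m k p} {P : Pred (Vec (Fin m) (suc k)) p} (P? : Decidable P) →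
    length (filter P? (vecs (suc k) m)) ≡ sum (λ x → length (filter (P? ∘ (x ∷_)) (vecs k m)))
  length-filter-vecs-suc {m} {k} P? = go id
    where
    go : ∀ {j} (g : Fin j → Fin m) →
      length (filter P? (concatMap (λ x → map (x ∷_) (vecs k m)) (tabulate g)))
        ≡ sum (λ x → length (filter (P? ∘ (g x ∷_)) (vecs k m)))
    go {zero}  g = refl
    go {suc j} g = trans
      (length-filter-++ P? (map (g zero ∷_) (vecs k m))
                           (concatMap (λ x → map (x ∷_) (vecs k m)) (tabulate (g ∘ suc))))
      (cong₂ _+_ (length-filter-map P? (g zero ∷_) (vecs k m)) (go (g ∘ suc)))

  sum-split : ∀ {n} {h f g : Fin n → ℕ} → (∀ x → h x ≡ f x + g x) → sum h ≡ sum f + sum g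
  sum-split {f = f} {g} h≗f+g = trans (sum-cong-≗ h≗f+g) (∑-distrib-+ f g)

  sum-ones : ∀ n → sum {n} (λ _ → 1) ≡ n
  sum-ones zero    = refl
  sum-ones (suc n) = cong suc (sum-ones n)

  ∑-δ : ∀ {n} (g : Fin n → ℕ) (y : Fin n) → sum (λ x → 𝟙 (does (x ≟ y)) * g x) ≡ g y
  ∑-δ {suc n} g zero    =
    trans (cong (g zero + 0 +_) (sum-replicate-zero n)) (trans (+-identityʳ _) (+-identityʳ _))
  ∑-δ {suc n} g (suc y) = ∑-δ (g ∘ suc) y

  subfactorial : ℕ → ℕ
  subfactorial 0             = 1
  subfactorial 1             = 0
  subfactorial (suc (suc n)) = suc n * (subfactorial (suc n) + subfactorial n)

  -- restricted a j : the number of permutations of a + j points having no fixed point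
  -- among a prescribed a of them.
  restricted : ℕ → ℕ → ℕ
  restricted a zero    = subfactorial a
  restricted a (suc j) = restricted (suc a) j + restricted a j

  restricted-sucˡ : ∀ a j → restricted (suc a) j ≡ a * restricted (pred a) (suc j) + j * restricted a j
  restricted-sucˡ zero    zero    = refl
  restricted-sucˡ (suc a) zero    = sym (+-identityʳ _)
  restricted-sucˡ zero    (suc j) =
    trans (cong₂ _+_ (restricted-sucˡ 1 j) (restricted-sucˡ 0 j))
          (regroup (restricted 1 j) (restricted 0 j) j)
    where
    regroup : ∀ x y j → 1 * (x + y) + j * x + j * y ≡ suc j * (x + y)
    regroup = solve-∀
  restricted-sucˡ (suc a) (suc j) =
    trans (cong₂ _+_ (restricted-sucˡ (suc (suc a)) j) (restricted-sucˡ (suc a) j))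
          (regroup (restricted (suc (suc a)) j) (restricted (suc a) j) (restricted a (suc j)) a j)
    where
    regroup : ∀ x y z a j → suc (suc a) * (x + y) + j * x + (suc a * z + j * y)
                            ≡ suc a * ((x + y) + z) + suc j * (x + y)
    regroup = solve-∀

  restricted-sucʳ : ∀ a j → restricted a (suc j) ≡ a * restricted (pred a) (suc j) + suc j * restricted a j
  restricted-sucʳ a j =
    trans (cong (_+ restricted a j) (restricted-sucˡ a j))
          (regroup (a * restricted (pred a) (suc j)) (restricted a j) j)
    where
    regroup : ∀ x y j → x + j * y + y ≡ x + suc j * y
    regroup = solve-∀

  -- b says whether the first position's own constraint is inactive.
  restricted-first-position : ∀ b a i →
    a * restricted (pred a) (suc i) + (𝟙 b + i) * restricted a i ≡ restricted (𝟙 (not b) + a) (𝟙 b + i)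
  restricted-first-position false a i = sym (restricted-sucˡ a i)
  restricted-first-position true  a i = sym (restricted-sucʳ a i)

  module _ {m : ℕ} where

    open import Data.Vec.Membership.DecPropositional (_≟_ {m}) using (_∉_; _∈?_)

    -- u lists the values used by the positions filled so far; f i is the value forbidden
    -- at position i.
    Admissible : ∀ {l k} → Vec (Fin m) l → Vec (Fin m) k → Vec (Fin m) k → Set
    Admissible u []      []      = ⊤
    Admissible u (y ∷ f) (x ∷ t) = (x ∉ u × x ≢ y) × Admissible (x ∷ u) f t

    admissible? : ∀ {l k} (u : Vec (Fin m) l) (f : Vec (Fin m) k) → Decidable (Admissible u f)
    admissible? u []      []      = yes tt
    admissible? u (y ∷ f) (x ∷ t) = (¬? (x ∈? u) ×-dec ¬? (x ≟ y)) ×-dec admissible? (x ∷ u) f t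

    InjectionAvoiding : ∀ {l k} → Vec (Fin m) l → Vec (Fin m) k → Vec (Fin m) k → Set
    InjectionAvoiding u f t =
      (∀ i → lookup t i ∉ u) × (∀ i j → lookup t i ≡ lookup t j → i ≡ j)
      × (∀ i → lookup t i ≢ lookup f i)

    admissible⇒injectionAvoiding : ∀ {l k} {u : Vec (Fin m) l} (f t : Vec (Fin m) k) →
      Admissible u f t → InjectionAvoiding u f t
    admissible⇒injectionAvoiding []      []      _ = (λ ()) , (λ ()) , (λ ())
    admissible⇒injectionAvoiding (y ∷ f) (x ∷ t) ((x∉u , x≢y) , adm)
      with admissible⇒injectionAvoiding f t adm
    ... | t∉x∷u , t-injective , t≢f = avoids , injective , λ { zero → x≢y ; (suc i) → t≢f i }
      where
      avoids : ∀ i → lookup (x ∷ t) i ∉ _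
      avoids zero    = x∉u
      avoids (suc i) = t∉x∷u i ∘ there
      injective : ∀ i j → lookup (x ∷ t) i ≡ lookup (x ∷ t) j → i ≡ j
      injective zero    zero    _  = refl
      injective zero    (suc j) eq = contradiction (here (sym eq)) (t∉x∷u j)
      injective (suc i) zero    eq = contradiction (here eq) (t∉x∷u i)
      injective (suc i) (suc j) eq = cong suc (t-injective i j eq)

    injectionAvoiding⇒admissible : ∀ {l k} {u : Vec (Fin m) l} (f t : Vec (Fin m) k) →
      InjectionAvoiding u f t → Admissible u f t
    injectionAvoiding⇒admissible []      []      _ = tt
    injectionAvoiding⇒admissible (y ∷ f) (x ∷ t) (avoids , injective , ≢f) =
      (avoids zero , ≢f zero) , injectionAvoiding⇒admissible f t (t∉x∷u , t-injective , ≢f ∘ suc)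
      where
      t∉x∷u : ∀ i → lookup t i ∉ x ∷ _
      t∉x∷u i (here eq)   = 0≢1+n (sym (injective (suc i) zero eq))
      t∉x∷u i (there t∈u) = avoids (suc i) t∈u
      t-injective : ∀ i j → lookup t i ≡ lookup t j → i ≡ j
      t-injective i j eq = Fin-suc-injective (injective (suc i) (suc j) eq)

    All≢⇒∉ : ∀ {k y} {w : Vec (Fin m) k} → All (y ≢_) w → y ∉ w
    All≢⇒∉ (y≢z ∷ _)   (here y≡z)  = y≢z y≡z
    All≢⇒∉ (_   ∷ y≢w) (there y∈w) = All≢⇒∉ y≢w y∈w

    #unused : ∀ {l} → Vec (Fin m) l → ℕ
    #unused u = sum (λ x → 𝟙 (not (does (x ∈? u))))

    #unused-[] : #unused [] ≡ m
    #unused-[] = sum-ones m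

    #unused-∷ : ∀ {l x} {u : Vec (Fin m) l} → x ∉ u → #unused u ≡ suc (#unused (x ∷ u))
    #unused-∷ {x = x} {u} x∉u = begin
      #unused u
        ≡⟨ sum-split (λ y → split (does (y ≟ x)) (does (y ∈? u))) ⟩
      sum (λ y → 𝟙 (does (y ≟ x)) * 𝟙 (not (does (y ∈? u)))) + #unused (x ∷ u)
        ≡⟨ cong (_+ #unused (x ∷ u)) (∑-δ (λ y → 𝟙 (not (does (y ∈? u)))) x) ⟩
      𝟙 (not (does (x ∈? u))) + #unused (x ∷ u)
        ≡⟨ cong (λ b → 𝟙 (not b) + #unused (x ∷ u)) (dec-false (x ∈? u) x∉u) ⟩
      suc (#unused (x ∷ u))
        ∎
      where
      open ≡-Reasoning
      split : ∀ e b → 𝟙 (not b) ≡ 𝟙 e * 𝟙 (not b) + 𝟙 (not (e ∨ b))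
      split true  true  = refl
      split true  false = refl
      split false b     = refl

    -- The constraint t i ≠ f i is active when f i is still unused, i.e. when it actually
    -- excludes a candidate value.
    active inactive : ∀ {l k} → Vec (Fin m) l → Vec (Fin m) k → ℕ
    active   u []      = 0
    active   u (y ∷ f) = 𝟙 (not (does (y ∈? u))) + active u f
    inactive u []      = 0
    inactive u (y ∷ f) = 𝟙 (does (y ∈? u)) + inactive u f

    active+inactive : ∀ {l k} (u : Vec (Fin m) l) (f : Vec (Fin m) k) → active u f + inactive u f ≡ k
    active+inactive u []      = refl
    active+inactive u (y ∷ f) with y ∈? u
    ... | yes _ = trans (+-suc (active u f) (inactive u f)) (cong suc (active+inactive u f))
    ... | no  _ = cong suc (active+inactive u f)

    active-[] : ∀ {k} (f : Vec (Fin m) k) → active [] f ≡ k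
    active-[] []      = refl
    active-[] (y ∷ f) = cong suc (active-[] f)

    inactive-[] : ∀ {k} (f : Vec (Fin m) k) → inactive [] f ≡ 0
    inactive-[] []      = refl
    inactive-[] (y ∷ f) = inactive-[] f

    active-∷ : ∀ {l k x} {u : Vec (Fin m) l} {f : Vec (Fin m) k} → x ∉ u → Unique f →
      active u f ≡ 𝟙 (does (x ∈? f)) + active (x ∷ u) f
    active-∷ x∉u [] = refl
    active-∷ {x = x} {u} {y ∷ f} x∉u (y∉f ∷ f!) with y ≟ x | x ≟ y
    ... | yes refl | no x≢x  = contradiction refl x≢x
    ... | no y≢x   | yes x≡y = contradiction (sym x≡y) y≢x
    ... | no _     | no _    = trans (cong (𝟙 (not (does (y ∈? u))) +_) (active-∷ x∉u f!))
                                     (x∙yz≈y∙xz (𝟙 (not (does (y ∈? u)))) (𝟙 (does (x ∈? f))) _)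
    ... | yes refl | yes refl
      rewrite dec-false (x ∈? u) x∉u | active-∷ x∉u f! | dec-false (x ∈? f) (All≢⇒∉ y∉f) = refl

    inactive-∷ : ∀ {l k x} {u : Vec (Fin m) l} {f : Vec (Fin m) k} → x ∉ u → Unique f →
      inactive (x ∷ u) f ≡ 𝟙 (does (x ∈? f)) + inactive u f
    inactive-∷ {k = k} {x} {u} {f} x∉u f! = +-cancelˡ-≡ (active (x ∷ u) f) _ _ (begin
      active (x ∷ u) f + inactive (x ∷ u) f                 ≡⟨ active+inactive (x ∷ u) f ⟩
      k                                                     ≡⟨ active+inactive u f ⟨
      active u f + inactive u f                             ≡⟨ cong (_+ inactive u f) (active-∷ x∉u f!) ⟩
      𝟙 (does (x ∈? f)) + active (x ∷ u) f + inactive u f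
        ≡⟨ xy∙z≈y∙xz (𝟙 (does (x ∈? f))) (active (x ∷ u) f) _ ⟩
      active (x ∷ u) f + (𝟙 (does (x ∈? f)) + inactive u f) ∎)
      where open ≡-Reasoning

    #unused∧∈≡active : ∀ {l k} (u : Vec (Fin m) l) {w : Vec (Fin m) k} → Unique w →
      sum (λ x → 𝟙 (not (does (x ∈? u)) ∧ does (x ∈? w))) ≡ active u w
    #unused∧∈≡active u [] =
      trans (sum-cong-≗ (λ x → cong 𝟙 (∧-zeroʳ (not (does (x ∈? u)))))) (sum-replicate-zero m)
    #unused∧∈≡active u {y ∷ w} (y∉w ∷ w!) = begin
      sum (λ x → 𝟙 (not (does (x ∈? u)) ∧ (does (x ≟ y) ∨ does (x ∈? w))))
        ≡⟨ sum-split split ⟩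
      sum (λ x → 𝟙 (does (x ≟ y)) * 𝟙 (not (does (x ∈? u))))
        + sum (λ x → 𝟙 (not (does (x ∈? u)) ∧ does (x ∈? w)))
        ≡⟨ cong₂ _+_ (∑-δ (λ x → 𝟙 (not (does (x ∈? u)))) y) (#unused∧∈≡active u w!) ⟩
      𝟙 (not (does (y ∈? u))) + active u w
        ∎
      where
      open ≡-Reasoning
      split : ∀ x → 𝟙 (not (does (x ∈? u)) ∧ (does (x ≟ y) ∨ does (x ∈? w)))
                    ≡ 𝟙 (does (x ≟ y)) * 𝟙 (not (does (x ∈? u)))
                      + 𝟙 (not (does (x ∈? u)) ∧ does (x ∈? w))
      split x with x ≟ y | x ∈? w | not (does (x ∈? u))
      ... | yes refl | yes x∈w | _     = contradiction x∈w (All≢⇒∉ y∉w)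
      ... | yes refl | no  _   | true  = refl
      ... | yes refl | no  _   | false = refl
      ... | no  _    | _       | _     = refl

    #unused∧∉≡inactive : ∀ {l k} (u : Vec (Fin m) l) {w : Vec (Fin m) k} → Unique w → #unused u ≡ k →
      sum (λ x → 𝟙 (not (does (x ∈? u)) ∧ not (does (x ∈? w)))) ≡ inactive u w
    #unused∧∉≡inactive {k = k} u {w} w! #unused≡k = +-cancelˡ-≡ (active u w) _ _ (begin
      active u w + #∉∉                                     ≡⟨ cong (_+ #∉∉) (#unused∧∈≡active u w!) ⟨
      sum (λ x → 𝟙 (not (does (x ∈? u)) ∧ does (x ∈? w))) + #∉∉
        ≡⟨ sum-split (λ x → 𝟙-∧-split (not (does (x ∈? u))) (does (x ∈? w))) ⟨
      #unused u                                            ≡⟨ #unused≡k ⟩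
      k                                                    ≡⟨ active+inactive u w ⟨
      active u w + inactive u w                            ∎)
      where
      open ≡-Reasoning
      #∉∉ = sum (λ x → 𝟙 (not (does (x ∈? u)) ∧ not (does (x ∈? w))))

    -- Choosing the value x of the first position: if x is the forbidden value of a later
    -- position, that constraint becomes inactive; otherwise the counts are unchanged.
    by-first-value : ∀ {l k y} {u : Vec (Fin m) l} {f : Vec (Fin m) k} (C : Fin m → ℕ) →
      All (y ≢_) f → Unique f →
      (∀ {x} → x ∉ u → C x ≡ restricted (active (x ∷ u) f) (inactive (x ∷ u) f)) →
      ∀ x → 𝟙 (not (does (x ∈? u)) ∧ not (does (x ≟ y))) * C x
            ≡ 𝟙 (not (does (x ∈? u)) ∧ does (x ∈? f)) * restricted (pred (active u f)) (suc (inactive u f))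
              + 𝟙 (not (does (x ∈? u)) ∧ not (does (x ≟ y) ∨ does (x ∈? f)))
                * restricted (active u f) (inactive u f)
    by-first-value {y = y} {u} {f} C y∉f f! C≡ x with x ∈? u
    ... | yes _   = refl
    ... | no  x∉u with x ∈? f | x ≟ y | active-∷ x∉u f! | inactive-∷ x∉u f!
    ...   | yes x∈f | yes refl | _  | _  = contradiction x∈f (All≢⇒∉ y∉f)
    ...   | no  _   | yes refl | _  | _  = refl
    ...   | yes _   | no  _    | a≡ | i≡ = trans
      (cong (_+ 0) (trans (C≡ x∉u) (cong₂ restricted (cong pred (sym a≡)) i≡)))
      (sym (+-identityʳ _))
    ...   | no  _   | no  _    | a≡ | i≡ =
      cong (_+ 0) (trans (C≡ x∉u) (cong₂ restricted (sym a≡) i≡))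

    #admissible≡restricted : ∀ {l k} (u : Vec (Fin m) l) (f : Vec (Fin m) k) → Unique f → #unused u ≡ k →
      length (filter (admissible? u f) (vecs k m)) ≡ restricted (active u f) (inactive u f)
    #admissible≡restricted u []      _ _ = refl
    #admissible≡restricted {k = suc k} u (y ∷ f) (y∉f ∷ f!) #unused≡ = begin
      length (filter (admissible? u (y ∷ f)) (vecs (suc k) m))
        ≡⟨ length-filter-vecs-suc (admissible? u (y ∷ f)) ⟩
      sum (λ x → length (filter (admissible? u (y ∷ f) ∘ (x ∷_)) (vecs k m)))
        ≡⟨ sum-cong-≗ (λ x → length-filter-×-dec (¬? (x ∈? u) ×-dec ¬? (x ≟ y))
                                                  (admissible? (x ∷ u) f) (vecs k m)) ⟩
      sum (λ x → 𝟙 (not (does (x ∈? u)) ∧ not (does (x ≟ y))) * #completions x)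
        ≡⟨ sum-split (by-first-value #completions y∉f f! #completions≡) ⟩
      sum (λ x → unused∧∈ x * V₁) + sum (λ x → unused∧∉ x * V₀)
        ≡⟨ cong₂ _+_ (*-distribʳ-sum V₁ unused∧∈) (*-distribʳ-sum V₀ unused∧∉) ⟨
      sum unused∧∈ * V₁ + sum unused∧∉ * V₀
        ≡⟨ cong₂ (λ a i → a * V₁ + i * V₀)
                 (#unused∧∈≡active u f!) (#unused∧∉≡inactive u (y∉f ∷ f!) #unused≡) ⟩
      active u f * V₁ + inactive u (y ∷ f) * V₀
        ≡⟨ restricted-first-position (does (y ∈? u)) (active u f) (inactive u f) ⟩
      restricted (active u (y ∷ f)) (inactive u (y ∷ f))
        ∎
      where
      open ≡-Reasoning
      V₁ V₀ : ℕ
      V₁ = restricted (pred (active u f)) (suc (inactive u f))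
      V₀ = restricted (active u f) (inactive u f)
      unused∧∈ unused∧∉ #completions : Fin m → ℕ
      unused∧∈ x = 𝟙 (not (does (x ∈? u)) ∧ does (x ∈? f))
      unused∧∉ x = 𝟙 (not (does (x ∈? u)) ∧ not (does (x ∈? (y ∷ f))))
      #completions x = length (filter (admissible? (x ∷ u) f) (vecs k m))
      #completions≡ : ∀ {x} → x ∉ u →
        #completions x ≡ restricted (active (x ∷ u) f) (inactive (x ∷ u) f)
      #completions≡ {x} x∉u =
        #admissible≡restricted (x ∷ u) f f! (suc-injective (trans (sym (#unused-∷ x∉u)) #unused≡))

  D≡subfactorial : ∀ n → D n ≡ subfactorial n
  D≡subfactorial n = begin
    length (filter (isDerangement? n) (vecs n n))
      ≡⟨ cong length (filter-≐ (isDerangement? n) (admissible? [] ids)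
                                (derangement⇒admissible , admissible⇒derangement) (vecs n n)) ⟩
    length (filter (admissible? [] ids) (vecs n n))
      ≡⟨ #admissible≡restricted [] ids (tabulate⁺ id) #unused-[] ⟩
    restricted (active [] ids) (inactive [] ids)
      ≡⟨ cong₂ restricted (active-[] ids) (inactive-[] ids) ⟩
    subfactorial n
      ∎
    where
    open ≡-Reasoning
    ids : Vec (Fin n) n
    ids = Vec.allFin n
    derangement⇒admissible : ∀ {σ} → IsDerangement n σ → Admissible [] ids σ
    derangement⇒admissible {σ} (injective , no-fixed-point) = injectionAvoiding⇒admissible ids σ
      ((λ _ ()) , injective , λ i eq → no-fixed-point i (trans eq (lookup-allFin i)))
    admissible⇒derangement : ∀ {σ} → Admissible [] ids σ → IsDerangement n σ
    admissible⇒derangement {σ} adm with admissible⇒injectionAvoiding ids σ adm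
    ... | _ , injective , ≢ids = injective , λ i eq → ≢ids i (trans eq (sym (lookup-allFin i)))

module Recurrences where

  open import Data.Nat.Base using (ℕ; zero; suc; _+_; _*_; _≤_; z≤n; s≤s; _!; NonZero)
  open import Data.Nat.Properties
  open import Data.Nat.Tactic.RingSolver using (solve-∀)
  open import Relation.Binary.PropositionalEquality
    using (_≡_; refl; sym; trans; cong; cong₂; subst; module ≡-Reasoning)
  open Derangements using (subfactorial)

  [even] [odd] : ℕ → ℕ
  [even] zero    = 1
  [even] (suc M) = [odd] M
  [odd]  zero    = 0
  [odd]  (suc M) = [even] M

  [even]+[odd] : ∀ M → [even] M + [odd] M ≡ 1
  [even]+[odd] zero    = refl
  [even]+[odd] (suc M) = trans (+-comm ([odd] M) ([even] M)) ([even]+[odd] M)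

  [odd]≤1 : ∀ M → [odd] M ≤ 1
  [odd]≤1 M = subst ([odd] M ≤_) ([even]+[odd] M) (m≤n+m ([odd] M) ([even] M))

  -- d (M + 1) = (M + 1) d M + (-1)^(M + 1), with the sign moved so that it stays in ℕ.
  subfactorial-suc : ∀ M → subfactorial (suc M) + [even] M ≡ suc M * subfactorial M + [odd] M
  subfactorial-suc zero    = refl
  subfactorial-suc (suc M) = begin
    suc M * (d₁ + d₀) + [odd] M          ≡⟨ distrib (suc M) d₁ d₀ ([odd] M) ⟩
    suc M * d₁ + (suc M * d₀ + [odd] M)  ≡⟨ cong (suc M * d₁ +_) (subfactorial-suc M) ⟨
    suc M * d₁ + (d₁ + [even] M)         ≡⟨ +-assoc (suc M * d₁) d₁ ([even] M) ⟨
    suc M * d₁ + d₁ + [even] M           ≡⟨ cong (_+ [even] M) (+-comm (suc M * d₁) d₁) ⟩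
    suc (suc M) * d₁ + [even] M          ∎
    where
    open ≡-Reasoning
    d₁ = subfactorial (suc M)
    d₀ = subfactorial M
    distrib : ∀ s x y o → s * (x + y) + o ≡ s * x + (s * y + o)
    distrib = solve-∀

  arrangements : ℕ → ℕ
  arrangements zero    = 1
  arrangements (suc M) = suc M * arrangements M + 1

  arrangements+subfactorial-suc : ∀ M →
    arrangements (suc M) + subfactorial (suc M) ≡ suc M * (arrangements M + subfactorial M) + 2 * [odd] M
  arrangements+subfactorial-suc M = +-cancelʳ-≡ ([even] M) _ _ (begin
    suc M * a + 1 + d₁ + [even] M                              ≡⟨ +-assoc (suc M * a + 1) d₁ ([even] M) ⟩
    suc M * a + 1 + (d₁ + [even] M)
      ≡⟨ cong₂ (λ one d → suc M * a + one + d) ([even]+[odd] M) (sym (subfactorial-suc M)) ⟨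
    suc M * a + ([even] M + [odd] M) + (suc M * d₀ + [odd] M)  ≡⟨ regroup (suc M) a d₀ ([even] M) ([odd] M) ⟩
    suc M * (a + d₀) + 2 * [odd] M + [even] M                  ∎)
    where
    open ≡-Reasoning
    a  = arrangements M
    d₀ = subfactorial M
    d₁ = subfactorial (suc M)
    regroup : ∀ s x y e o → s * x + (e + o) + (s * y + o) ≡ s * (x + y) + 2 * o + e
    regroup = solve-∀

  rising : ℕ → ℕ → ℕ
  rising n zero    = 1
  rising n (suc j) = suc (n + j) * rising n j

  rising-nonZero : ∀ n j → NonZero (rising n j)
  rising-nonZero n zero    = _
  rising-nonZero n (suc j) = m*n≢0 (suc (n + j)) (rising n j) {{_}} {{rising-nonZero n j}}

  !-rising : ∀ n j → (n + j) ! ≡ n ! * rising n j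
  !-rising n zero    = trans (cong _! (+-identityʳ n)) (sym (*-identityʳ (n !)))
  !-rising n (suc j) = begin
    (n + suc j) !                    ≡⟨ cong _! (+-suc n j) ⟩
    suc (n + j) * (n + j) !          ≡⟨ cong (suc (n + j) *_) (!-rising n j) ⟩
    suc (n + j) * (n ! * rising n j) ≡⟨ swap (suc (n + j)) (n !) (rising n j) ⟩
    n ! * rising n (suc j)           ∎
    where
    open ≡-Reasoning
    swap : ∀ x y z → x * (y * z) ≡ y * (x * z)
    swap = solve-∀

  tail : (ℕ → ℕ) → ℕ → ℕ → ℕ
  tail c n zero    = 0
  tail c n (suc j) = suc (n + j) * tail c n j + c (n + j)

  unroll : ∀ (F c : ℕ → ℕ) → (∀ M → F (suc M) ≡ suc M * F M + c M) →
    ∀ n j → F (n + j) ≡ rising n j * F n + tail c n j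
  unroll F c rec n zero    = trans (cong F (+-identityʳ n)) (sym (trans (+-identityʳ _) (+-identityʳ _)))
  unroll F c rec n (suc j) = begin
    F (n + suc j)                                    ≡⟨ cong F (+-suc n j) ⟩
    F (suc (n + j))                                  ≡⟨ rec (n + j) ⟩
    suc (n + j) * F (n + j) + c (n + j)
      ≡⟨ cong (λ x → suc (n + j) * x + c (n + j)) (unroll F c rec n j) ⟩
    suc (n + j) * (rising n j * F n + tail c n j) + c (n + j)
      ≡⟨ regroup (suc (n + j)) (rising n j) (F n) (tail c n j) (c (n + j)) ⟩
    rising n (suc j) * F n + tail c n (suc j)        ∎
    where
    open ≡-Reasoning
    regroup : ∀ s p f t c → s * (p * f + t) + c ≡ s * p * f + (s * t + c)
    regroup = solve-∀

  tail-bound : ∀ {c n} → (∀ M → n ≤ M → 3 * c M ≤ 2 * M) → ∀ j → 3 * tail c n j + 2 ≤ 2 * rising n j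
  tail-bound small zero            = ≤-refl
  tail-bound {c} {n} small (suc j) = +-cancelʳ-≤ (2 * s) _ _ (begin
    3 * (s * T + c M) + 2 + 2 * s      ≡⟨ regroup s T (c M) ⟩
    s * (3 * T + 2) + (3 * c M + 2)
      ≤⟨ +-mono-≤ (*-monoʳ-≤ s (tail-bound small j)) (+-monoˡ-≤ 2 (small M (m≤m+n n j))) ⟩
    s * (2 * rising n j) + (2 * M + 2) ≡⟨ regroup′ s (rising n j) M ⟩
    2 * (s * rising n j) + 2 * s       ∎)
    where
    open ≤-Reasoning
    M = n + j
    s = suc M
    T = tail c n j
    regroup : ∀ s t c → 3 * (s * t + c) + 2 + 2 * s ≡ s * (3 * t + 2) + (3 * c + 2)
    regroup = solve-∀
    regroup′ : ∀ s p M → s * (2 * p) + (2 * M + 2) ≡ 2 * (s * p) + 2 * suc M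
    regroup′ = solve-∀

  2≤m⇒3≤2*m : ∀ {m} → 2 ≤ m → 3 ≤ 2 * m
  2≤m⇒3≤2*m 2≤m = ≤-trans (n≤1+n 3) (*-monoʳ-≤ 2 2≤m)

  2≤m⇒6*[odd]m≤2*m : ∀ {m} → 2 ≤ m → 3 * (2 * [odd] m) ≤ 2 * m
  2≤m⇒6*[odd]m≤2*m {1}                 (s≤s ())
  2≤m⇒6*[odd]m≤2*m {2}                 _ = z≤n
  2≤m⇒6*[odd]m≤2*m {suc (suc (suc m))} _ =
    ≤-trans (*-monoʳ-≤ 3 (*-monoʳ-≤ 2 ([odd]≤1 (3 + m)))) (*-monoʳ-≤ 2 (s≤s (s≤s (s≤s z≤n))))

module PartialSums where

  open import Data.Integer.Base as ℤ using (ℤ)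
  import Data.Integer.Properties as ℤ
  open import Data.Nat.Base as ℕ using (ℕ; zero; suc; _!)
  import Data.Nat.Properties as ℕ
  import Data.Nat.Tactic.RingSolver as ℕ-Solver
  import Data.Nat.Coprimality as Coprime
  open import Data.Product.Base using (_×_; _,_; proj₁; proj₂)
  open import Data.Rational.Base
  open import Data.Rational.Properties
  open import Relation.Binary.PropositionalEquality
    using (_≡_; refl; sym; trans; cong; cong₂; subst; subst₂; module ≡-Reasoning)
  open import Relation.Nullary.Decidable using (dec⇒maybe)
  import Tactic.RingSolver.Core.AlmostCommutativeRing as ACR
  open import Tactic.RingSolver using (solve-∀)
  open import Defs using (ℕ→ℚ; ℤ→ℚ; inv!; sign; eₚ; e⁻¹ₚ; FloorLim; Eventually)
  open Derangements using (subfactorial)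
  open Recurrences

  ℚ-ring : ACR.AlmostCommutativeRing _ _
  ℚ-ring = ACR.fromCommutativeRing +-*-commutativeRing (λ q → dec⇒maybe (0ℚ ≟ q))

  ℕ→ℚ-mkℚ : ∀ a → ℕ→ℚ a ≡ mkℚ (ℤ.+ a) 0 (Coprime.sym (Coprime.1-coprimeTo a))
  ℕ→ℚ-mkℚ a = fromℚᵘ-toℚᵘ (mkℚ (ℤ.+ a) 0 (Coprime.sym (Coprime.1-coprimeTo a)))

  ℕ→ℚ-homo-+ : ∀ a b → ℕ→ℚ (a ℕ.+ b) ≡ ℕ→ℚ a + ℕ→ℚ b
  ℕ→ℚ-homo-+ a b rewrite ℕ→ℚ-mkℚ a | ℕ→ℚ-mkℚ b =
    sym (cong₂ (λ x y → (x ℤ.+ y) / 1) (ℤ.*-identityʳ (ℤ.+ a)) (ℤ.*-identityʳ (ℤ.+ b)))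

  ℕ→ℚ-homo-* : ∀ a b → ℕ→ℚ (a ℕ.* b) ≡ ℕ→ℚ a * ℕ→ℚ b
  ℕ→ℚ-homo-* a b rewrite ℕ→ℚ-mkℚ a | ℕ→ℚ-mkℚ b = cong (_/ 1) (ℤ.pos-* a b)

  ℕ→ℚ-mono-≤ : ∀ {a b} → a ℕ.≤ b → ℕ→ℚ a ≤ ℕ→ℚ b
  ℕ→ℚ-mono-≤ {a} {b} a≤b rewrite ℕ→ℚ-mkℚ a | ℕ→ℚ-mkℚ b =
    *≤* (subst₂ ℤ._≤_ (sym (ℤ.*-identityʳ (ℤ.+ a))) (sym (ℤ.*-identityʳ (ℤ.+ b)))
                      (ℤ.+≤+ a≤b))

  ℕ→ℚ-pos : ∀ a .{{_ : ℕ.NonZero a}} → Positive (ℕ→ℚ a)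
  ℕ→ℚ-pos (suc a) = normalize-pos (suc a) 1

  1/c*c≡1 : ∀ c .{{_ : ℕ.NonZero c}} → (ℤ.+ 1 / c) * ℕ→ℚ c ≡ 1ℚ
  1/c*c≡1 (suc c) = trans
    (cong₂ _*_ (normalize-coprime (Coprime.1-coprimeTo (suc c))) (ℕ→ℚ-mkℚ (suc c)))
    (*-inverseˡ (mkℚ (ℤ.+ suc c) 0 (Coprime.sym (Coprime.1-coprimeTo (suc c)))))

  inv!*! : ∀ k → inv! k * ℕ→ℚ (k !) ≡ 1ℚ
  inv!*! k = 1/c*c≡1 (k !) {{k ℕ.!≢0}}

  sign+[odd]≡[even] : ∀ k → sign k + ℕ→ℚ ([odd] k) ≡ ℕ→ℚ ([even] k)
  sign+[odd]≡[even] zero    = refl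
  sign+[odd]≡[even] (suc k) =
    trans (cong ((0ℚ - sign k) +_) (sym (sign+[odd]≡[even] k))) (cancel (sign k) (ℕ→ℚ ([odd] k)))
    where
    cancel : ∀ s o → (0ℚ - s) + (s + o) ≡ o
    cancel = solve-∀ ℚ-ring

  partial-sum-step : ∀ x y M →
    (x + y) * ℕ→ℚ (suc M !) ≡ ℕ→ℚ (suc M) * (x * ℕ→ℚ (M !)) + y * ℕ→ℚ (suc M !)
  partial-sum-step x y M = begin
    (x + y) * ℕ→ℚ (suc M !)                             ≡⟨ *-distribʳ-+ (ℕ→ℚ (suc M !)) x y ⟩
    x * ℕ→ℚ (suc M !) + y * ℕ→ℚ (suc M !)
      ≡⟨ cong (λ z → x * z + y * ℕ→ℚ (suc M !)) (ℕ→ℚ-homo-* (suc M) (M !)) ⟩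
    x * (ℕ→ℚ (suc M) * ℕ→ℚ (M !)) + y * ℕ→ℚ (suc M !)
      ≡⟨ cong (_+ y * ℕ→ℚ (suc M !)) (swap x (ℕ→ℚ (suc M)) (ℕ→ℚ (M !))) ⟩
    ℕ→ℚ (suc M) * (x * ℕ→ℚ (M !)) + y * ℕ→ℚ (suc M !)   ∎
    where
    open ≡-Reasoning
    swap : ∀ x a b → x * (a * b) ≡ a * (x * b)
    swap = solve-∀ ℚ-ring

  eₚ-scaled : ∀ M → eₚ M * ℕ→ℚ (M !) ≡ ℕ→ℚ (arrangements M)
  eₚ-scaled zero    = refl
  eₚ-scaled (suc M) = begin
    (eₚ M + inv! (suc M)) * ℕ→ℚ (suc M !)
      ≡⟨ partial-sum-step (eₚ M) (inv! (suc M)) M ⟩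
    ℕ→ℚ (suc M) * (eₚ M * ℕ→ℚ (M !)) + inv! (suc M) * ℕ→ℚ (suc M !)
      ≡⟨ cong₂ (λ z w → ℕ→ℚ (suc M) * z + w) (eₚ-scaled M) (inv!*! (suc M)) ⟩
    ℕ→ℚ (suc M) * ℕ→ℚ (arrangements M) + 1ℚ
      ≡⟨ cong (_+ 1ℚ) (ℕ→ℚ-homo-* (suc M) (arrangements M)) ⟨
    ℕ→ℚ (suc M ℕ.* arrangements M) + ℕ→ℚ 1
      ≡⟨ ℕ→ℚ-homo-+ (suc M ℕ.* arrangements M) 1 ⟨
    ℕ→ℚ (arrangements (suc M))
      ∎
    where open ≡-Reasoning

  e⁻¹ₚ-scaled : ∀ M → e⁻¹ₚ M * ℕ→ℚ (M !) ≡ ℕ→ℚ (subfactorial M)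
  e⁻¹ₚ-scaled zero    = refl
  e⁻¹ₚ-scaled (suc M) = begin
    (e⁻¹ₚ M + σ * inv! (suc M)) * ℕ→ℚ (suc M !)
      ≡⟨ partial-sum-step (e⁻¹ₚ M) (σ * inv! (suc M)) M ⟩
    ℕ→ℚ (suc M) * (e⁻¹ₚ M * ℕ→ℚ (M !)) + σ * inv! (suc M) * ℕ→ℚ (suc M !)
      ≡⟨ cong₂ (λ z w → ℕ→ℚ (suc M) * z + w) (e⁻¹ₚ-scaled M) σ-term ⟩
    S + σ                                ≡⟨ add-sub σ E S ⟩
    (S + (σ + E)) - E                    ≡⟨ cong (λ z → (S + z) - E) (sign+[odd]≡[even] (suc M)) ⟩
    (S + O) - E                          ≡⟨ cong (_- E) recurrence ⟨
    (ℕ→ℚ (subfactorial (suc M)) + E) - E ≡⟨ sub-add (ℕ→ℚ (subfactorial (suc M))) E ⟩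
    ℕ→ℚ (subfactorial (suc M))           ∎
    where
    open ≡-Reasoning
    σ S E O : ℚ
    σ = sign (suc M)
    S = ℕ→ℚ (suc M) * ℕ→ℚ (subfactorial M)
    E = ℕ→ℚ ([even] M)
    O = ℕ→ℚ ([odd] M)
    σ-term : σ * inv! (suc M) * ℕ→ℚ (suc M !) ≡ σ
    σ-term = trans (*-assoc σ _ _) (trans (cong (σ *_) (inv!*! (suc M))) (*-identityʳ σ))
    recurrence : ℕ→ℚ (subfactorial (suc M)) + E ≡ S + O
    recurrence = begin
      ℕ→ℚ (subfactorial (suc M)) + E              ≡⟨ ℕ→ℚ-homo-+ (subfactorial (suc M)) ([even] M) ⟨
      ℕ→ℚ (subfactorial (suc M) ℕ.+ [even] M)     ≡⟨ cong ℕ→ℚ (subfactorial-suc M) ⟩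
      ℕ→ℚ (suc M ℕ.* subfactorial M ℕ.+ [odd] M)  ≡⟨ ℕ→ℚ-homo-+ (suc M ℕ.* subfactorial M) ([odd] M) ⟩
      ℕ→ℚ (suc M ℕ.* subfactorial M) + O          ≡⟨ cong (_+ O) (ℕ→ℚ-homo-* (suc M) (subfactorial M)) ⟩
      S + O                                       ∎
    add-sub : ∀ σ e s → s + σ ≡ (s + (σ + e)) - e
    add-sub = solve-∀ ℚ-ring
    sub-add : ∀ d e → (d + e) - e ≡ d
    sub-add = solve-∀ ℚ-ring

  [eₚ+e⁻¹ₚ]-scaled : ∀ M → (eₚ M + e⁻¹ₚ M) * ℕ→ℚ (M !) ≡ ℕ→ℚ (arrangements M ℕ.+ subfactorial M)
  [eₚ+e⁻¹ₚ]-scaled M = begin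
    (eₚ M + e⁻¹ₚ M) * ℕ→ℚ (M !)                  ≡⟨ *-distribʳ-+ (ℕ→ℚ (M !)) (eₚ M) (e⁻¹ₚ M) ⟩
    eₚ M * ℕ→ℚ (M !) + e⁻¹ₚ M * ℕ→ℚ (M !)        ≡⟨ cong₂ _+_ (eₚ-scaled M) (e⁻¹ₚ-scaled M) ⟩
    ℕ→ℚ (arrangements M) + ℕ→ℚ (subfactorial M)  ≡⟨ ℕ→ℚ-homo-+ (arrangements M) (subfactorial M) ⟨
    ℕ→ℚ (arrangements M ℕ.+ subfactorial M)      ∎
    where open ≡-Reasoning

  ⅓ : ℚ
  ⅓ = ℤ.+ 1 / 3

  floorLim-intro : ∀ {s : ℕ → ℚ} {b : ℤ} (δ : ℚ) → 0ℚ < δ →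
    Eventually (λ M → ℤ→ℚ b ≤ s M × s M ≤ (ℤ→ℚ b + 1ℚ) - δ) → FloorLim s b
  floorLim-intro {b = b} δ δ>0 (N , bounds) =
    (λ ε ε>0 → N , λ M N≤M → ≤-trans (b-ε≤b ε>0) (proj₁ (bounds M N≤M))) ,
    δ , δ>0 , N , λ M N≤M → proj₂ (bounds M N≤M)
    where
    b-ε≤b : ∀ {ε} → 0ℚ < ε → ℤ→ℚ b - ε ≤ ℤ→ℚ b
    b-ε≤b ε>0 =
      ≤-trans (+-monoʳ-≤ (ℤ→ℚ b) (neg-antimono-≤ (<⇒≤ ε>0))) (≤-reflexive (+-identityʳ (ℤ→ℚ b)))

  fraction-bounds : ∀ (y : ℚ) (p b r : ℕ) .{{_ : ℕ.NonZero p}} → 3 ℕ.* r ℕ.≤ 2 ℕ.* p →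
    y * ℕ→ℚ p ≡ ℕ→ℚ (p ℕ.* b ℕ.+ r) → ℕ→ℚ b ≤ y × y ≤ (ℕ→ℚ b + 1ℚ) - ⅓
  fraction-bounds y p b r 3r≤2p y*p≡ = lower , upper
    where
    open ≤-Reasoning
    P B 3′ : ℚ
    P  = ℕ→ℚ p
    B  = ℕ→ℚ b
    3′ = ℕ→ℚ 3
    instance
      P-pos : Positive P
      P-pos = ℕ→ℚ-pos p
      P3-pos : Positive (P * 3′)
      P3-pos = pos*pos⇒pos P 3′
    lower : B ≤ y
    lower = *-cancelʳ-≤-pos P (begin
      B * P                ≡⟨ ℕ→ℚ-homo-* b p ⟨
      ℕ→ℚ (b ℕ.* p)        ≤⟨ ℕ→ℚ-mono-≤ (subst₂ ℕ._≤_ (ℕ.*-comm p b) refl (ℕ.m≤m+n (p ℕ.* b) r)) ⟩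
      ℕ→ℚ (p ℕ.* b ℕ.+ r)  ≡⟨ y*p≡ ⟨
      y * P                ∎)
    scaled : (p ℕ.* b ℕ.+ r) ℕ.* 3 ℕ.≤ p ℕ.* (b ℕ.* 3 ℕ.+ 2)
    scaled = subst₂ ℕ._≤_ (expand₁ p b r) (expand₂ p b) (ℕ.+-monoʳ-≤ (3 ℕ.* (p ℕ.* b)) 3r≤2p)
      where
      expand₁ : ∀ p b r → 3 ℕ.* (p ℕ.* b) ℕ.+ 3 ℕ.* r ≡ (p ℕ.* b ℕ.+ r) ℕ.* 3
      expand₁ = ℕ-Solver.solve-∀
      expand₂ : ∀ p b → 3 ℕ.* (p ℕ.* b) ℕ.+ 2 ℕ.* p ≡ p ℕ.* (b ℕ.* 3 ℕ.+ 2)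
      expand₂ = ℕ-Solver.solve-∀
    -- The subtraction 1ℚ * 3′ - ⅓ * 3′ evaluates to ℕ→ℚ 2 by computation.
    bound*3P : ((B + 1ℚ) - ⅓) * (P * 3′) ≡ ℕ→ℚ (p ℕ.* (b ℕ.* 3 ℕ.+ 2))
    bound*3P = sym (begin-equality
      ℕ→ℚ (p ℕ.* (b ℕ.* 3 ℕ.+ 2))        ≡⟨ ℕ→ℚ-homo-* p (b ℕ.* 3 ℕ.+ 2) ⟩
      P * ℕ→ℚ (b ℕ.* 3 ℕ.+ 2)
        ≡⟨ cong (P *_) (trans (ℕ→ℚ-homo-+ (b ℕ.* 3) 2) (cong (_+ ℕ→ℚ 2) (ℕ→ℚ-homo-* b 3))) ⟩
      P * (B * 3′ + (1ℚ * 3′ - ⅓ * 3′))  ≡⟨ expand B ⅓ P 3′ ⟨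
      ((B + 1ℚ) - ⅓) * (P * 3′)          ∎)
      where
      expand : ∀ B t P c → ((B + 1ℚ) - t) * (P * c) ≡ P * (B * c + (1ℚ * c - t * c))
      expand = solve-∀ ℚ-ring
    upper : y ≤ (B + 1ℚ) - ⅓
    upper = *-cancelʳ-≤-pos (P * 3′) (begin
      y * (P * 3′)                  ≡⟨ *-assoc y P 3′ ⟨
      y * P * 3′                    ≡⟨ cong (_* 3′) y*p≡ ⟩
      ℕ→ℚ (p ℕ.* b ℕ.+ r) * 3′      ≡⟨ ℕ→ℚ-homo-* (p ℕ.* b ℕ.+ r) 3 ⟨
      ℕ→ℚ ((p ℕ.* b ℕ.+ r) ℕ.* 3)   ≤⟨ ℕ→ℚ-mono-≤ scaled ⟩
      ℕ→ℚ (p ℕ.* (b ℕ.* 3 ℕ.+ 2))   ≡⟨ bound*3P ⟨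
      ((B + 1ℚ) - ⅓) * (P * 3′)     ∎)

  floorLim-scaled : ∀ (x : ℕ → ℚ) (F c : ℕ → ℕ) n →
    (∀ M → x M * ℕ→ℚ (M !) ≡ ℕ→ℚ (F M)) →
    (∀ M → F (suc M) ≡ suc M ℕ.* F M ℕ.+ c M) →
    (∀ M → n ℕ.≤ M → 3 ℕ.* c M ℕ.≤ 2 ℕ.* M) →
    FloorLim (λ M → x M * ℕ→ℚ (n !)) (ℤ.+ F n)
  floorLim-scaled x F c n x-scaled rec small = floorLim-intro {b = ℤ.+ F n} ⅓ (positive⁻¹ ⅓)
    (n , λ M n≤M → subst Bounds (ℕ.m+[n∸m]≡n n≤M) (bounds (M ℕ.∸ n)))
    where
    Bounds : ℕ → Set
    Bounds M = ℕ→ℚ (F n) ≤ x M * ℕ→ℚ (n !) × x M * ℕ→ℚ (n !) ≤ (ℕ→ℚ (F n) + 1ℚ) - ⅓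
    x[n+j]-scaled : ∀ j →
      x (n ℕ.+ j) * ℕ→ℚ (n !) * ℕ→ℚ (rising n j) ≡ ℕ→ℚ (rising n j ℕ.* F n ℕ.+ tail c n j)
    x[n+j]-scaled j = begin
      x M * ℕ→ℚ (n !) * ℕ→ℚ (rising n j)       ≡⟨ *-assoc (x M) (ℕ→ℚ (n !)) (ℕ→ℚ (rising n j)) ⟩
      x M * (ℕ→ℚ (n !) * ℕ→ℚ (rising n j))     ≡⟨ cong (x M *_) (ℕ→ℚ-homo-* (n !) (rising n j)) ⟨
      x M * ℕ→ℚ (n ! ℕ.* rising n j)           ≡⟨ cong (λ z → x M * ℕ→ℚ z) (!-rising n j) ⟨
      x M * ℕ→ℚ (M !)                          ≡⟨ x-scaled M ⟩
      ℕ→ℚ (F M)                                ≡⟨ cong ℕ→ℚ (unroll F c rec n j) ⟩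
      ℕ→ℚ (rising n j ℕ.* F n ℕ.+ tail c n j)  ∎
      where
      open ≡-Reasoning
      M = n ℕ.+ j
    bounds : ∀ j → Bounds (n ℕ.+ j)
    bounds j = fraction-bounds (x (n ℕ.+ j) * ℕ→ℚ (n !)) (rising n j) (F n) (tail c n j)
      {{rising-nonZero n j}} (ℕ.≤-trans (ℕ.m≤m+n _ 2) (tail-bound small j)) (x[n+j]-scaled j)

open import Data.Integer.Base using (ℤ; +_; _-_)
open import Data.Integer.Properties using ([+m]-[+n]≡m⊖n; ⊖-≥)
open import Data.Nat.Base using (ℕ; _≤_; _+_; _*_)
open import Data.Nat.Properties using (≤-trans; m≤m+n; m+n∸m≡n)
open import Data.Product.Base using (Σ; _×_; _,_)
import Data.Rational.Base as ℚ
open import Relation.Binary.PropositionalEquality using (_≡_; refl; sym; trans; cong)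
open import Defs using (FloorLim; [e+e⁻¹]·n!; e·n!; D; eₚ; e⁻¹ₚ)
open Derangements using (subfactorial; D≡subfactorial)
open Recurrences using (arrangements; [odd]; arrangements+subfactorial-suc; 2≤m⇒3≤2*m; 2≤m⇒6*[odd]m≤2*m)
open PartialSums using (floorLim-scaled; eₚ-scaled; [eₚ+e⁻¹ₚ]-scaled)

+[m+n]-+m≡+n : ∀ m n → + (m + n) - + m ≡ + n
+[m+n]-+m≡+n m n =
  trans ([+m]-[+n]≡m⊖n (m + n) m) (trans (⊖-≥ (m≤m+n m n)) (cong +_ (m+n∸m≡n m n)))

corollary3 : (n : ℕ) → 2 ≤ n →
    Σ ℤ λ a → Σ ℤ λ b →
      FloorLim ([e+e⁻¹]·n! n) a × FloorLim (e·n! n) b × + D n ≡ a - b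
corollary3 n 2≤n =
  + (arrangements n + subfactorial n) , + arrangements n ,
  floorLim-scaled (λ M → eₚ M ℚ.+ e⁻¹ₚ M) (λ M → arrangements M + subfactorial M)
    (λ M → 2 * [odd] M) n [eₚ+e⁻¹ₚ]-scaled arrangements+subfactorial-suc
    (λ _ n≤M → 2≤m⇒6*[odd]m≤2*m (≤-trans 2≤n n≤M)) ,
  floorLim-scaled eₚ arrangements (λ _ → 1) n eₚ-scaled (λ _ → refl)
    (λ _ n≤M → 2≤m⇒3≤2*m (≤-trans 2≤n n≤M)) ,
  trans (cong +_ (D≡subfactorial n)) (sym (+[m+n]-+m≡+n (arrangements n) (subfactorial n)))
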